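{- For every $x>15000$, $$\mathcal N_B(x)\ge e^{d(\sqrt{\ln x})}.$$
   Context: A Nov\'ak number is a positive integer $N$ with $N\mid 2^N+1$; $\mathcal N_B(x)$ is the number of Nov\'ak numbers not exceeding $x$. For $y\ge1$, $d(y)=\max\{\omega(2^N+1): N\le y,\ N\text{ a Nov\'ak number}\}$, where $\omega(m)$ is the number of distinct prime factors of $m$.
   Formalization: The number x ranges over the rationals greater than 15000. -}

module Defs where

open import Data.Nat as ℕ using (ℕ; zero; suc; _^_; _≤_)
open import Data.Nat.Divisibility using (_∣_; _∣?_)
open import Data.Nat.Primality using (Prime; prime?)
open import Data.List using (List; length; filter; upTo)
open import Data.Integer as ℤ using (ℤ; +_)
open import Data.Rational as ℚ using (ℚ; _/_; floor)
open import Data.Product using (_×_)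
open import Relation.Nullary.Decidable using (Dec; yes; no; _×-dec_)

-- ω m : number of distinct prime divisors of m (primes p ≤ m with p ∣ m;
-- for m ≥ 1 every prime divisor is ≤ m)
ω : ℕ → ℕ
ω m = length (filter (λ p → prime? p ×-dec (p ∣? m)) (upTo (suc m)))

Novak : ℕ → Set
Novak N = (1 ≤ N) × (N ∣ 2 ^ N ℕ.+ 1)

novak? : (N : ℕ) → Dec (Novak N)
novak? N = (1 ℕ.≤? N) ×-dec (N ∣? 2 ^ N ℕ.+ 1)

novakCountℕ : ℕ → ℕ
novakCountℕ n = length (filter novak? (upTo (suc n)))

𝒩B : ℚ → ℕ
𝒩B x = novakCountℕ (ℤ.∣ floor x ∣)

expTerm : ℕ → ℕ → ℚ
expTerm a zero = ℚ.1ℚ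
expTerm a (suc i) = expTerm a i ℚ.* ((+ a) / suc i)

expPartial : ℕ → ℕ → ℚ
expPartial a zero = ℚ.1ℚ
expPartial a (suc j) = expPartial a j ℚ.+ expTerm a (suc j)

-- e^a ≤ q   (e^a is the supremum of the increasing partial sums)
ExpLe : ℕ → ℚ → Set
ExpLe a q = ∀ j → expPartial a j ℚ.≤ q

-- m ≤ √(ln x)  ⇔  e^(m²) ≤ x   (for x > 0)
LeSqrtLn : ℕ → ℚ → Set
LeSqrtLn m x = ExpLe (m ℕ.* m) x

-- d(y) for y ≥ 1 restricted to integer arguments: max ω(2^N+1) over Novák N ≤ m.
-- Since d(y) only depends on ⌊y⌋, d(√ln x) = d(⌊√ln x⌋).
d : ℕ → ℕ
d zero = 0
d (suc m) with novak? (suc m)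
... | yes _ = ℕ._⊔_ (d m) (ω (2 ^ suc m ℕ.+ 1))
... | no _ = d m

{-# OPTIONS --safe #-}
-- Take a Novák number N ≤ m with k = ω(2^N + 1) = d(m), and let T = 2^N + 1.
-- If n is Novák with T ∣ 2^n + 1 and q ∣ T, then q is odd and
-- (2^n)^q + 1 = (2^n + 1)(q + (2^n + 1) h), so nq is again Novák with T ∣ 2^(nq) + 1.
-- Hence the 13^k products N ∏ p^(e_p) over the primes p ∣ T, with 0 ≤ e_p ≤ 12,
-- are distinct Novák numbers, all at most N T^12 ≤ 4^⌊m²/4⌋ ≤ e^(m²) ≤ x once m ≥ 27,
-- while e^k ≤ 2^(3k+2) ≤ 13^k for k ≥ 3. If k ≤ 2 then e^k ≤ 8, and already eight
-- Novák numbers lie below 513; and k ≥ 3 forces N ≥ 27 because d(26) = 2.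
module Submission where

open import Defs
open import Data.Nat as ℕ
  using (ℕ; zero; suc; _+_; _*_; _^_; _∸_; _!; _≤_; _≤?_; z≤n; s≤s; NonZero)
open import Data.Nat.Properties
open import Data.Nat.DivMod using (_%_; m≡m%n+[m/n]*n; m%n<n; m/n*n≤m; m*n/n≡m; /-monoˡ-≤)
  renaming (_/_ to _div_)
open import Data.Nat.Divisibility
open import Data.Nat.Primality using (Prime; prime?; euclidsLemma; prime⇒irreducible; prime⇒nonTrivial; prime⇒nonZero)
open import Data.Nat.Tactic.RingSolver using (solve-∀)
open import Data.Integer as ℤ using (ℤ; +_; -_; 0ℤ; 1ℤ; +≤+)
import Data.Integer.Properties as ℤP
import Data.Integer.Tactic.RingSolver as ℤ-Solver
open import Data.Rational as ℚ using (ℚ; _<_; _/_; mkℚ; toℚᵘ; floor)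
import Data.Rational.Properties as ℚP
open import Data.Rational.Unnormalised as ℚᵘ using (ℚᵘ; *≡*; *≤*; _≃_)
import Data.Rational.Unnormalised.Properties as ℚᵘP
open import Data.List using (List; []; _∷_; [_]; map; _++_; length; filter; upTo)
open import Data.List.Properties using (length-map; length-++)
open import Data.List.Membership.Propositional using (_∈_)
open import Data.List.Membership.Propositional.Properties
  using (∈-map⁻; ∈-++⁻; ∈-++⁺ˡ; ∈-++⁺ʳ; ∈-∃++; ∈-filter⁺; ∈-filter⁻; ∈-upTo⁺; ∈-upTo⁻)
open import Data.List.Relation.Unary.Unique.Propositional using (Unique)
import Data.List.Relation.Unary.Unique.Propositional.Properties as Unique
open import Data.List.Relation.Unary.All as All using (All; []; _∷_)
open import Data.List.Relation.Unary.Any using (here; there)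
import Data.List.Relation.Unary.AllPairs as AllPairs
open import Data.Product using (∃-syntax; _,_; _×_; proj₁; proj₂)
open import Data.Sum using (inj₁; inj₂; [_,_]′)
open import Relation.Binary.PropositionalEquality hiding ([_]; J)
open import Relation.Nullary using (¬_; yes; no; contradiction)
open import Relation.Nullary.Decidable using (_×-dec_)

private
  variable
    p q m n : ℕ


-- Divisibility of u ^ c + 1 for odd c
geometric : ℤ → ℕ → ℤ
geometric v zero    = 0ℤ
geometric v (suc q) = 1ℤ ℤ.+ v ℤ.* geometric v q

[1-v]*geometric≡1-v^q : ∀ v q → (1ℤ ℤ.- v) ℤ.* geometric v q ≡ 1ℤ ℤ.- v ℤ.^ q
[1-v]*geometric≡1-v^q v zero    = ℤP.*-zeroʳ (1ℤ ℤ.- v)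
[1-v]*geometric≡1-v^q v (suc q) = begin
  (1ℤ ℤ.- v) ℤ.* (1ℤ ℤ.+ v ℤ.* g)            ≡⟨ unfold v g ⟩
  (1ℤ ℤ.- v) ℤ.+ v ℤ.* ((1ℤ ℤ.- v) ℤ.* g)    ≡⟨ cong (λ z → (1ℤ ℤ.- v) ℤ.+ v ℤ.* z) ([1-v]*geometric≡1-v^q v q) ⟩
  (1ℤ ℤ.- v) ℤ.+ v ℤ.* (1ℤ ℤ.- v ℤ.^ q)      ≡⟨ fold v (v ℤ.^ q) ⟩
  1ℤ ℤ.- v ℤ.* v ℤ.^ q                        ∎
  where
  open ≡-Reasoning
  g = geometric v q
  unfold : ∀ v g → (1ℤ ℤ.- v) ℤ.* (1ℤ ℤ.+ v ℤ.* g) ≡ (1ℤ ℤ.- v) ℤ.+ v ℤ.* ((1ℤ ℤ.- v) ℤ.* g)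
  unfold = ℤ-Solver.solve-∀
  fold : ∀ v w → (1ℤ ℤ.- v) ℤ.+ v ℤ.* (1ℤ ℤ.- w) ≡ 1ℤ ℤ.- v ℤ.* w
  fold = ℤ-Solver.solve-∀

-- Each v^i is 1 modulo 1 - v.
geometric≡q-mod-[1-v] : ∀ v q → ∃[ h ] geometric v q ≡ + q ℤ.+ (1ℤ ℤ.- v) ℤ.* h
geometric≡q-mod-[1-v] v zero = 0ℤ , sym (trans (ℤP.+-identityˡ _) (ℤP.*-zeroʳ (1ℤ ℤ.- v)))
geometric≡q-mod-[1-v] v (suc q) with geometric≡q-mod-[1-v] v q
... | h , eq = v ℤ.* h ℤ.- + q , (begin
  1ℤ ℤ.+ v ℤ.* geometric v q                          ≡⟨ cong (λ z → 1ℤ ℤ.+ v ℤ.* z) eq ⟩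
  1ℤ ℤ.+ v ℤ.* (+ q ℤ.+ (1ℤ ℤ.- v) ℤ.* h)             ≡⟨ regroup v (+ q) h ⟩
  (1ℤ ℤ.+ + q) ℤ.+ (1ℤ ℤ.- v) ℤ.* (v ℤ.* h ℤ.- + q)  ∎)
  where
  open ≡-Reasoning
  regroup : ∀ v q h → 1ℤ ℤ.+ v ℤ.* (q ℤ.+ (1ℤ ℤ.- v) ℤ.* h) ≡ (1ℤ ℤ.+ q) ℤ.+ (1ℤ ℤ.- v) ℤ.* (v ℤ.* h ℤ.- q)
  regroup = ℤ-Solver.solve-∀

[-x]^odd≡-x^odd : ∀ x t → (- x) ℤ.^ suc (2 * t) ≡ - (x ℤ.^ suc (2 * t))
[-x]^odd≡-x^odd x t = begin
  - x ℤ.* (- x) ℤ.^ (2 * t)    ≡⟨ cong (- x ℤ.*_) (sym (ℤP.^-*-assoc (- x) 2 t)) ⟩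
  - x ℤ.* ((- x) ℤ.^ 2) ℤ.^ t  ≡⟨ cong (λ z → - x ℤ.* z ℤ.^ t) (square-neg x) ⟩
  - x ℤ.* (x ℤ.^ 2) ℤ.^ t      ≡⟨ cong (- x ℤ.*_) (ℤP.^-*-assoc x 2 t) ⟩
  - x ℤ.* x ℤ.^ (2 * t)        ≡⟨ sym (ℤP.neg-distribˡ-* x _) ⟩
  - (x ℤ.* x ℤ.^ (2 * t))      ∎
  where
  open ≡-Reasoning
  square-neg : ∀ x → (- x) ℤ.* ((- x) ℤ.* 1ℤ) ≡ x ℤ.* (x ℤ.* 1ℤ)
  square-neg = ℤ-Solver.solve-∀

pos-^ : ∀ m n → + (m ^ n) ≡ (+ m) ℤ.^ n
pos-^ m zero    = refl
pos-^ m (suc n) = trans (ℤP.pos-* m (m ^ n)) (cong (+ m ℤ.*_) (pos-^ m n))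

1-[-u]≡u+1 : ∀ u → 1ℤ ℤ.- - + u ≡ + (u + 1)
1-[-u]≡u+1 u = trans (ℤP.+-comm 1ℤ (- - + u)) (trans (cong (ℤ._+ 1ℤ) (ℤP.neg-involutive (+ u))) (sym (ℤP.pos-+ u 1)))

u^odd+1≡[u+1]*geometric : ∀ u t → + (u ^ suc (2 * t) + 1) ≡ + (u + 1) ℤ.* geometric (- + u) (suc (2 * t))
u^odd+1≡[u+1]*geometric u t = begin
  + (u ^ c + 1)                         ≡⟨ ℤP.pos-+ (u ^ c) 1 ⟩
  + (u ^ c) ℤ.+ 1ℤ                      ≡⟨ cong (ℤ._+ 1ℤ) (pos-^ u c) ⟩
  (+ u) ℤ.^ c ℤ.+ 1ℤ                    ≡⟨ as-difference ((+ u) ℤ.^ c) ⟩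
  1ℤ ℤ.- - ((+ u) ℤ.^ c)                ≡⟨ cong (λ z → 1ℤ ℤ.- z) (sym ([-x]^odd≡-x^odd (+ u) t)) ⟩
  1ℤ ℤ.- (- + u) ℤ.^ c                  ≡⟨ sym ([1-v]*geometric≡1-v^q (- + u) c) ⟩
  (1ℤ ℤ.- - + u) ℤ.* geometric (- + u) c ≡⟨ cong (ℤ._* geometric (- + u) c) (1-[-u]≡u+1 u) ⟩
  + (u + 1) ℤ.* geometric (- + u) c     ∎
  where
  open ≡-Reasoning
  c = suc (2 * t)
  as-difference : ∀ y → y ℤ.+ 1ℤ ≡ 1ℤ ℤ.- - y
  as-difference = ℤ-Solver.solve-∀

+n≡+m*k⇒m∣n : ∀ {m n} k → + n ≡ + m ℤ.* k → m ∣ n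
+n≡+m*k⇒m∣n {m} {n} k eq = divides ℤ.∣ k ∣ (begin
  n               ≡⟨ cong ℤ.∣_∣ eq ⟩
  ℤ.∣ + m ℤ.* k ∣ ≡⟨ ℤP.abs-* (+ m) k ⟩
  m * ℤ.∣ k ∣     ≡⟨ *-comm m ℤ.∣ k ∣ ⟩
  ℤ.∣ k ∣ * m     ∎)
  where open ≡-Reasoning

u+1∣u^odd+1 : ∀ u t → u + 1 ∣ u ^ suc (2 * t) + 1
u+1∣u^odd+1 u t = +n≡+m*k⇒m∣n _ (u^odd+1≡[u+1]*geometric u t)

-- u^c + 1 = (u + 1) (c + (u + 1) h) for odd c, and n c divides both summands.
*-∣-u^odd+1 : ∀ {u n} t → n ∣ u + 1 → suc (2 * t) ∣ u + 1 → n * suc (2 * t) ∣ u ^ suc (2 * t) + 1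
*-∣-u^odd+1 {u} {n} t (divides b u+1≡bn) (divides a u+1≡ac) with geometric≡q-mod-[1-v] (- + u) (suc (2 * t))
... | h , geometric≡ = +n≡+m*k⇒m∣n K (begin
  + (u ^ c + 1)                                   ≡⟨ u^odd+1≡[u+1]*geometric u t ⟩
  + (u + 1) ℤ.* geometric (- + u) c               ≡⟨ cong (+ (u + 1) ℤ.*_) geometric≡ ⟩
  + (u + 1) ℤ.* (+ c ℤ.+ (1ℤ ℤ.- - + u) ℤ.* h)    ≡⟨ cong₂ (λ x y → x ℤ.* (+ c ℤ.+ y ℤ.* h)) u+1≡b*n u+1≡a*c ⟩
  (+ b ℤ.* + n) ℤ.* (+ c ℤ.+ (+ a ℤ.* + c) ℤ.* h) ≡⟨ factor (+ b) (+ n) (+ c) (+ a) h ⟩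
  (+ n ℤ.* + c) ℤ.* K                             ≡⟨ cong (ℤ._* K) (ℤP.pos-* n c) ⟨
  + (n * c) ℤ.* K                                 ∎)
  where
  open ≡-Reasoning
  c = suc (2 * t)
  K = + b ℤ.* (1ℤ ℤ.+ + a ℤ.* h)
  u+1≡b*n : + (u + 1) ≡ + b ℤ.* + n
  u+1≡b*n = trans (cong +_ u+1≡bn) (ℤP.pos-* b n)
  u+1≡a*c : 1ℤ ℤ.- - + u ≡ + a ℤ.* + c
  u+1≡a*c = trans (1-[-u]≡u+1 u) (trans (cong +_ u+1≡ac) (ℤP.pos-* a c))
  factor : ∀ b n c a h → (b ℤ.* n) ℤ.* (c ℤ.+ (a ℤ.* c) ℤ.* h) ≡ (n ℤ.* c) ℤ.* (b ℤ.* (1ℤ ℤ.+ a ℤ.* h))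
  factor = ℤ-Solver.solve-∀

∣odd⇒odd : ∀ {q} k → q ∣ suc (2 * k) → ∃[ t ] q ≡ suc (2 * t)
∣odd⇒odd {q} k q∣odd with q % 2 | m%n<n q 2 | m≡m%n+[m/n]*n q 2
... | 0 | _ | q≡[q/2]*2 with ∣-trans (divides (q div 2) q≡[q/2]*2) q∣odd
...   | divides j odd≡j*2 = contradiction (trans (*-comm 2 j) (sym odd≡j*2)) (even≢odd j k)
∣odd⇒odd {q} k q∣odd | 1 | _ | q≡1+[q/2]*2 = q div 2 , trans q≡1+[q/2]*2 (cong suc (*-comm (q div 2) 2))
∣odd⇒odd {q} k q∣odd | suc (suc _) | s≤s (s≤s ()) | _


-- Products of prime powers
prime∤1 : Prime p → ¬ p ∣ 1
prime∤1 pp p∣1 = ℕ.nonTrivial⇒≢1 {{prime⇒nonTrivial pp}} (∣1⇒≡1 p∣1)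

prime∣prime⇒≡ : Prime p → Prime q → p ∣ q → p ≡ q
prime∣prime⇒≡ pp pq p∣q with prime⇒irreducible pq p∣q
... | inj₁ p≡1 = contradiction (subst (_∣ 1) (sym p≡1) ∣-refl) (prime∤1 pp)
... | inj₂ p≡q = p≡q

prime∣^⇒∣ : ∀ e → Prime p → p ∣ m ^ e → p ∣ m
prime∣^⇒∣ zero    pp p∣1 = contradiction p∣1 (prime∤1 pp)
prime∣^⇒∣ {m = m} (suc e) pp p∣m*m^e with euclidsLemma m (m ^ e) pp p∣m*m^e
... | inj₁ p∣m   = p∣m
... | inj₂ p∣m^e = prime∣^⇒∣ e pp p∣m^e

prime^∣*-cancelˡ : ∀ e n → Prime p → ¬ p ∣ m → p ^ e ∣ m * n → p ^ e ∣ n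
prime^∣*-cancelˡ zero n pp p∤m _ = 1∣ n
prime^∣*-cancelˡ {p} {m} (suc e) n pp p∤m p^[1+e]∣mn with euclidsLemma m n pp (m*n∣⇒m∣ p (p ^ e) p^[1+e]∣mn)
... | inj₁ p∣m = contradiction p∣m p∤m
... | inj₂ (divides k refl) =
  subst (p * p ^ e ∣_) (*-comm p k) (*-monoʳ-∣ p (prime^∣*-cancelˡ e k pp p∤m p^e∣mk))
  where
  p^e∣mk : p ^ e ∣ m * k
  p^e∣mk = *-cancelˡ-∣ p {{prime⇒nonZero pp}}
    (subst (p * p ^ e ∣_) (trans (sym (*-assoc m k p)) (*-comm (m * k) p)) p^[1+e]∣mn)

prime^-nonZero : Prime p → ∀ e → NonZero (p ^ e)
prime^-nonZero {p} pp e = m^n≢0 p e {{prime⇒nonZero pp}}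

prime^[1+e]∤p^e′*m : ∀ {e e′} → Prime p → ¬ p ∣ m → e′ ≤ e → ¬ p ^ suc e ∣ p ^ e′ * m
prime^[1+e]∤p^e′*m {p} {m} {e} {e′} pp p∤m e′≤e p^[1+e]∣ =
  <⇒≱ (^-monoʳ-< p (ℕ.nonTrivial⇒n>1 p {{prime⇒nonTrivial pp}}) (s≤s e′≤e))
      (∣⇒≤ {{prime^-nonZero pp e′}} (prime^∣*-cancelˡ (suc e) (p ^ e′) pp p∤m
        (subst (p ^ suc e ∣_) (*-comm (p ^ e′) m) p^[1+e]∣)))

powMultiples : ℕ → ℕ → List ℕ → List ℕ
powMultiples p zero    bs = map (p ^ 0 *_) bs
powMultiples p (suc r) bs = powMultiples p r bs ++ map (p ^ suc r *_) bs

length-powMultiples : ∀ p r bs → length (powMultiples p r bs) ≡ suc r * length bs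
length-powMultiples p zero    bs = trans (length-map _ bs) (sym (+-identityʳ (length bs)))
length-powMultiples p (suc r) bs = begin
  length (powMultiples p r bs ++ map (p ^ suc r *_) bs)      ≡⟨ length-++ (powMultiples p r bs) ⟩
  length (powMultiples p r bs) + length (map (p ^ suc r *_) bs) ≡⟨ cong₂ _+_ (length-powMultiples p r bs) (length-map _ bs) ⟩
  suc r * length bs + length bs                               ≡⟨ +-comm (suc r * length bs) (length bs) ⟩
  suc (suc r) * length bs                                     ∎
  where open ≡-Reasoning

∈-powMultiples⁻ : ∀ p r bs {a} → a ∈ powMultiples p r bs → ∃[ e ] ∃[ b ] e ≤ r × b ∈ bs × a ≡ p ^ e * b
∈-powMultiples⁻ p zero bs a∈ with ∈-map⁻ _ a∈
... | b , b∈ , refl = 0 , b , z≤n , b∈ , refl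
∈-powMultiples⁻ p (suc r) bs a∈ with ∈-++⁻ (powMultiples p r bs) a∈
... | inj₁ a∈′ with ∈-powMultiples⁻ p r bs a∈′
...   | e , b , e≤r , b∈ , refl = e , b , m≤n⇒m≤1+n e≤r , b∈ , refl
∈-powMultiples⁻ p (suc r) bs a∈ | inj₂ a∈′ with ∈-map⁻ _ a∈′
...   | b , b∈ , refl = suc r , b , ≤-refl , b∈ , refl

powMultiples-Unique : ∀ r bs → Prime p → All (λ b → ¬ p ∣ b) bs → Unique bs → Unique (powMultiples p r bs)
powMultiples-Unique {p} r bs pp p∤bs bs! = go r
  where
  map-Unique : ∀ e → Unique (map (p ^ e *_) bs)
  map-Unique e = Unique.map⁺ (*-cancelˡ-≡ _ _ (p ^ e) {{prime^-nonZero pp e}}) bs!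
  go : ∀ r → Unique (powMultiples p r bs)
  go zero    = map-Unique 0
  go (suc r) = Unique.++⁺ (go r) (map-Unique (suc r)) disjoint
    where
    disjoint : ∀ {a} → ¬ (a ∈ powMultiples p r bs × a ∈ map (p ^ suc r *_) bs)
    disjoint (a∈ , a∈′) with ∈-powMultiples⁻ p r bs a∈ | ∈-map⁻ _ a∈′
    ... | e , b , e≤r , b∈ , refl | c , _ , a≡ =
      prime^[1+e]∤p^e′*m pp (All.lookup p∤bs b∈) e≤r (subst (p ^ suc r ∣_) (sym a≡) (m∣m*n c))

products : ℕ → List ℕ → List ℕ
products r []       = [ 1 ]
products r (p ∷ ps) = powMultiples p r (products r ps)

length-products : ∀ r ps → length (products r ps) ≡ suc r ^ length ps
length-products r []       = refl
length-products r (p ∷ ps) = trans (length-powMultiples p r (products r ps)) (cong (suc r *_) (length-products r ps))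

∈-products⇒prime∣⇒∈ : ∀ r ps {a} → All Prime ps → a ∈ products r ps → Prime q → q ∣ a → q ∈ ps
∈-products⇒prime∣⇒∈ r []       _          (here refl) pq q∣1 = contradiction q∣1 (prime∤1 pq)
∈-products⇒prime∣⇒∈ r (p ∷ ps) (pp ∷ pps) a∈ pq q∣a with ∈-powMultiples⁻ p r (products r ps) a∈
... | e , b , _ , b∈ , refl with euclidsLemma (p ^ e) b pq q∣a
...   | inj₁ q∣p^e = here (prime∣prime⇒≡ pq pp (prime∣^⇒∣ e pq q∣p^e))
...   | inj₂ q∣b   = there (∈-products⇒prime∣⇒∈ r ps pps b∈ pq q∣b)

∉⇒∤products : ∀ r ps {b} → All Prime ps → Unique (p ∷ ps) → Prime p → b ∈ products r ps → ¬ p ∣ b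
∉⇒∤products r ps pps (p∉ AllPairs.∷ _) pp b∈ p∣b = All.lookup p∉ (∈-products⇒prime∣⇒∈ r ps pps b∈ pp p∣b) refl

products-Unique : ∀ r ps → All Prime ps → Unique ps → Unique (products r ps)
products-Unique r []       _          _              = [] AllPairs.∷ AllPairs.[]
products-Unique r (p ∷ ps) (pp ∷ pps) ps!@(_ AllPairs.∷ ps′!) =
  powMultiples-Unique r (products r ps) pp (All.tabulate (∉⇒∤products r ps pps ps! pp))
    (products-Unique r ps pps ps′!)

^-mono-∣ : ∀ e → m ∣ n → m ^ e ∣ n ^ e
^-mono-∣ zero    _   = ∣-refl
^-mono-∣ (suc e) m∣n = *-pres-∣ m∣n (^-mono-∣ e m∣n)

^-monoʳ-∣ : ∀ m {e r} → e ≤ r → m ^ e ∣ m ^ r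
^-monoʳ-∣ m {e} {r} e≤r = divides (m ^ (r ∸ e)) (begin
  m ^ r               ≡⟨ cong (m ^_) (m+[n∸m]≡n e≤r) ⟨
  m ^ (e + (r ∸ e))   ≡⟨ ^-distribˡ-+-* m e (r ∸ e) ⟩
  m ^ e * m ^ (r ∸ e) ≡⟨ *-comm (m ^ e) _ ⟩
  m ^ (r ∸ e) * m ^ e ∎)
  where open ≡-Reasoning

∈-products⇒∣^ : ∀ r ps {a} T → All Prime ps → Unique ps → All (_∣ T) ps → a ∈ products r ps → a ∣ T ^ r
∈-products⇒∣^ r []       T _          _    _            (here refl) = 1∣ _
∈-products⇒∣^ r (p ∷ ps) T (pp ∷ pps) ps! (p∣T ∷ ps∣T) a∈ with ∈-powMultiples⁻ p r (products r ps) a∈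
... | e , b , e≤r , b∈ , refl with ∈-products⇒∣^ r ps T pps (AllPairs.tail ps!) ps∣T b∈
...   | divides c T^r≡cb = subst (p ^ e * b ∣_) (sym T^r≡cb) (*-monoˡ-∣ b p^e∣c)
  where
  p^e∣c : p ^ e ∣ c
  p^e∣c = prime^∣*-cancelˡ e c pp (∉⇒∤products r ps pps ps! pp b∈)
    (subst (p ^ e ∣_) (trans T^r≡cb (*-comm c b)) (∣-trans (^-mono-∣ e p∣T) (^-monoʳ-∣ T e≤r)))


-- Novák numbers generated by the prime divisors of 2 ^ N + 1
NovakFor : ℕ → ℕ → Set
NovakFor T n = Novak n × T ∣ 2 ^ n + 1

NovakFor-*-∣ : ∀ {T n q} → NovakFor T n → q ∣ T → NovakFor T (n * q)
NovakFor-*-∣ {n = zero} ((() , _) , _)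
NovakFor-*-∣ {T} {n@(suc n′)} {q} ((_ , n∣2^n+1) , T∣2^n+1) q∣T =
  lift (∣odd⇒odd (2 ^ n′) (subst (q ∣_) (+-comm (2 ^ n) 1) q∣2^n+1))
  where
  q∣2^n+1 : q ∣ 2 ^ n + 1
  q∣2^n+1 = ∣-trans q∣T T∣2^n+1
  lift : ∃[ t ] q ≡ suc (2 * t) → NovakFor T (n * q)
  lift (t , refl) =
      (s≤s z≤n , subst (λ v → n * q ∣ v + 1) (^-*-assoc 2 n q) (*-∣-u^odd+1 t n∣2^n+1 q∣2^n+1))
    , ∣-trans T∣2^n+1 (subst (λ v → 2 ^ n + 1 ∣ v + 1) (^-*-assoc 2 n q) (u+1∣u^odd+1 (2 ^ n) t))

NovakFor-*-^ : ∀ {T n p} → NovakFor T n → p ∣ T → ∀ e → NovakFor T (n * p ^ e)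
NovakFor-*-^ {T} {n} {p} h p∣T zero    = subst (NovakFor T) (sym (*-identityʳ n)) h
NovakFor-*-^ {T} {n} {p} h p∣T (suc e) =
  subst (NovakFor T) (reorder n (p ^ e) p) (NovakFor-*-∣ (NovakFor-*-^ h p∣T e) p∣T)
  where
  reorder : ∀ n x p → n * x * p ≡ n * (p * x)
  reorder n x p = trans (*-assoc n x p) (cong (n *_) (*-comm x p))

NovakFor-*-products : ∀ {T n} r ps {a} → NovakFor T n → All (_∣ T) ps → a ∈ products r ps → NovakFor T (n * a)
NovakFor-*-products {T} {n} r []       h _ (here refl) = subst (NovakFor T) (sym (*-identityʳ n)) h
NovakFor-*-products {T} {n} r (p ∷ ps) h (p∣T ∷ ps∣T) a∈ with ∈-powMultiples⁻ p r (products r ps) a∈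
... | e , b , _ , b∈ , refl =
  subst (NovakFor T) (*-assoc n (p ^ e) b) (NovakFor-*-products r ps (NovakFor-*-^ h p∣T e) ps∣T b∈)

Unique-⊆⇒length≤ : ∀ {A : Set} (xs ys : List A) → Unique xs → (∀ {x} → x ∈ xs → x ∈ ys) → length xs ≤ length ys
Unique-⊆⇒length≤ []       ys _                 _  = z≤n
Unique-⊆⇒length≤ (x ∷ xs) ys (x∉xs AllPairs.∷ xs!) xs⊆ys with ∈-∃++ (xs⊆ys (here refl))
... | us , vs , refl = subst (suc (length xs) ≤_) (sym length-us++x∷vs)
                         (s≤s (Unique-⊆⇒length≤ xs (us ++ vs) xs! xs⊆us++vs))
  where
  length-us++x∷vs : length (us ++ [ x ] ++ vs) ≡ suc (length (us ++ vs))
  length-us++x∷vs = trans (length-++ us) (trans (+-suc (length us) (length vs)) (cong suc (sym (length-++ us))))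
  xs⊆us++vs : ∀ {y} → y ∈ xs → y ∈ us ++ vs
  xs⊆us++vs y∈xs with ∈-++⁻ us (xs⊆ys (there y∈xs))
  ... | inj₁ y∈us          = ∈-++⁺ˡ y∈us
  ... | inj₂ (here refl)   = contradiction refl (All.lookup x∉xs y∈xs)
  ... | inj₂ (there y∈vs) = ∈-++⁺ʳ us y∈vs

length≤novakCount : ∀ X (ns : List ℕ) → Unique ns → All (λ n → n ≤ X × Novak n) ns → length ns ≤ novakCountℕ X
length≤novakCount X ns ns! ns-novak = Unique-⊆⇒length≤ ns _ ns! λ n∈ →
  let (n≤X , nv) = All.lookup ns-novak n∈ in ∈-filter⁺ novak? (∈-upTo⁺ (s≤s n≤X)) nv

primeDivisors : ℕ → List ℕ
primeDivisors m = filter (λ p → prime? p ×-dec p ∣? m) (upTo (suc m))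

primeDivisors-prime∧∣ : ∀ m → All (λ p → Prime p × p ∣ m) (primeDivisors m)
primeDivisors-prime∧∣ m = All.tabulate (λ p∈ → proj₂ (∈-filter⁻ (λ p → prime? p ×-dec p ∣? m) {xs = upTo (suc m)} p∈))

primeDivisors-Unique : ∀ m → Unique (primeDivisors m)
primeDivisors-Unique m = Unique.filter⁺ (λ p → prime? p ×-dec p ∣? m) (Unique.upTo⁺ (suc m))

[1+r]^ω≤novakCount : ∀ r {N X} → Novak N → N * (2 ^ N + 1) ^ r ≤ X → suc r ^ ω (2 ^ N + 1) ≤ novakCountℕ X
[1+r]^ω≤novakCount r {N} {X} nv NT^r≤X =
  subst (_≤ novakCountℕ X) (trans (length-map (N *_) (products r ps)) (length-products r ps))
    (length≤novakCount X (map (N *_) (products r ps)) Nps-Unique (All.tabulate bounded-novak))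
  where
  T = 2 ^ N + 1
  ps = primeDivisors T
  ps-prime = All.map proj₁ (primeDivisors-prime∧∣ T)
  ps∣T = All.map proj₂ (primeDivisors-prime∧∣ T)
  instance
    N≢0 : NonZero N
    N≢0 = ℕ.>-nonZero (proj₁ nv)
    T^r≢0 : NonZero (T ^ r)
    T^r≢0 = m^n≢0 T r {{ℕ.>-nonZero (m≤n+m 1 (2 ^ N))}}
  Nps-Unique : Unique (map (N *_) (products r ps))
  Nps-Unique = Unique.map⁺ (*-cancelˡ-≡ _ _ N) (products-Unique r ps ps-prime (primeDivisors-Unique T))
  bounded-novak : ∀ {n} → n ∈ map (N *_) (products r ps) → n ≤ X × Novak n
  bounded-novak n∈ with ∈-map⁻ (N *_) n∈
  ... | a , a∈ , refl = ≤-trans (*-monoʳ-≤ N (∣⇒≤ (∈-products⇒∣^ r ps T ps-prime (primeDivisors-Unique T) ps∣T a∈))) NT^r≤X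
                      , proj₁ (NovakFor-*-products r ps (nv , ∣-refl) ps∣T a∈)


-- Partial sums of the exponential series
n/d*n′/d′≃m/D : ∀ {n n′ m} d d′ D .{{_ : NonZero d}} .{{_ : NonZero d′}} .{{_ : NonZero D}} →
          n * n′ * D ≡ m * (d * d′) → (+ n ℚᵘ./ d) ℚᵘ.* (+ n′ ℚᵘ./ d′) ≃ + m ℚᵘ./ D
n/d*n′/d′≃m/D {n} {n′} {m} (suc d) (suc d′) (suc D) eq = *≡* (begin
  + n ℤ.* + n′ ℤ.* + suc D       ≡⟨ cong (ℤ._* + suc D) (ℤP.pos-* n n′) ⟨
  + (n * n′) ℤ.* + suc D         ≡⟨ ℤP.pos-* (n * n′) (suc D) ⟨
  + (n * n′ * suc D)             ≡⟨ cong +_ eq ⟩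
  + (m * (suc d * suc d′))       ≡⟨ ℤP.pos-* m (suc d * suc d′) ⟩
  + m ℤ.* + (suc d * suc d′)     ∎)
  where open ≡-Reasoning

n/d+n′/d′≃m/D : ∀ {n n′ m} d d′ D .{{_ : NonZero d}} .{{_ : NonZero d′}} .{{_ : NonZero D}} →
          (n * d′ + n′ * d) * D ≡ m * (d * d′) → (+ n ℚᵘ./ d) ℚᵘ.+ (+ n′ ℚᵘ./ d′) ≃ + m ℚᵘ./ D
n/d+n′/d′≃m/D {n} {n′} {m} d@(suc _) d′@(suc _) D@(suc _) eq = *≡* (begin
  (+ n ℤ.* + d′ ℤ.+ + n′ ℤ.* + d) ℤ.* + D ≡⟨ cong (ℤ._* + D) (cong₂ ℤ._+_ (ℤP.pos-* n d′) (ℤP.pos-* n′ d)) ⟨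
  (+ (n * d′) ℤ.+ + (n′ * d)) ℤ.* + D     ≡⟨ cong (ℤ._* + D) (ℤP.pos-+ (n * d′) (n′ * d)) ⟨
  + (n * d′ + n′ * d) ℤ.* + D             ≡⟨ ℤP.pos-* (n * d′ + n′ * d) D ⟨
  + ((n * d′ + n′ * d) * D)               ≡⟨ cong +_ eq ⟩
  + (m * (d * d′))                        ≡⟨ ℤP.pos-* m (d * d′) ⟩
  + m ℤ.* + (d * d′)                      ∎)
  where open ≡-Reasoning

n/d≤n′/d′ : ∀ {n n′} d d′ .{{_ : NonZero d}} .{{_ : NonZero d′}} → n * d′ ≤ n′ * d → + n ℚᵘ./ d ℚᵘ.≤ + n′ ℚᵘ./ d′
n/d≤n′/d′ {n} {n′} d@(suc _) d′@(suc _) le =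
  *≤* (subst₂ ℤ._≤_ (ℤP.pos-* n d′) (ℤP.pos-* n′ d) (+≤+ le))

infix 7 _÷_!
_÷_! : ℕ → ℕ → ℚᵘ
n ÷ j ! = ℚᵘ._/_ (+ n) (j ℕ.!) {{j !≢0}}

expPartialNum : ℕ → ℕ → ℕ
expPartialNum a zero    = 1
expPartialNum a (suc j) = suc j * expPartialNum a j + a ^ suc j

toℚᵘ-expTerm : ∀ a j → toℚᵘ (expTerm a j) ≃ a ^ j ÷ j !
toℚᵘ-expTerm a zero    = ℚᵘP.≃-refl
toℚᵘ-expTerm a (suc j) = begin
  toℚᵘ (expTerm a j ℚ.* (+ a / suc j))         ≈⟨ ℚP.toℚᵘ-homo-* (expTerm a j) (+ a / suc j) ⟩
  toℚᵘ (expTerm a j) ℚᵘ.* toℚᵘ (+ a / suc j)   ≈⟨ ℚᵘP.*-cong (toℚᵘ-expTerm a j) (ℚP.toℚᵘ-fromℚᵘ (+ a ℚᵘ./ suc j)) ⟩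
  (a ^ j ÷ j !) ℚᵘ.* (+ a ℚᵘ./ suc j)          ≈⟨ n/d*n′/d′≃m/D (j !) (suc j) (suc j !) {{j !≢0}} {{_}} {{suc j !≢0}}
                                                    (reorder (a ^ j) a j (j !)) ⟩
  a ^ suc j ÷ suc j !                          ∎
  where
  open ℚᵘP.≃-Reasoning
  reorder : ∀ x a j f → x * a * (suc j * f) ≡ a * x * (f * suc j)
  reorder = solve-∀

toℚᵘ-expPartial : ∀ a j → toℚᵘ (expPartial a j) ≃ expPartialNum a j ÷ j !
toℚᵘ-expPartial a zero    = ℚᵘP.≃-refl
toℚᵘ-expPartial a (suc j) = begin
  toℚᵘ (expPartial a j ℚ.+ expTerm a (suc j))          ≈⟨ ℚP.toℚᵘ-homo-+ (expPartial a j) (expTerm a (suc j)) ⟩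
  toℚᵘ (expPartial a j) ℚᵘ.+ toℚᵘ (expTerm a (suc j))  ≈⟨ ℚᵘP.+-cong (toℚᵘ-expPartial a j) (toℚᵘ-expTerm a (suc j)) ⟩
  (W ÷ j !) ℚᵘ.+ (a ^ suc j ÷ suc j !)                 ≈⟨ n/d+n′/d′≃m/D (j !) (suc j !) (suc j !) {{j !≢0}} {{suc j !≢0}} {{suc j !≢0}}
                                                             (common-denominator W (j !) j (a ^ suc j)) ⟩
  expPartialNum a (suc j) ÷ suc j !                    ∎
  where
  open ℚᵘP.≃-Reasoning
  W = expPartialNum a j
  common-denominator : ∀ w f j A → (w * (suc j * f) + A * f) * (suc j * f) ≡ (suc j * w + A) * (f * (suc j * f))
  common-denominator = solve-∀

expPartial≤ : ∀ {a} j c → expPartialNum a j ≤ c * j ! → expPartial a j ℚ.≤ + c / 1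
expPartial≤ {a} j c W≤c*j! = ℚP.toℚᵘ-cancel-≤
  (ℚᵘP.≤-respˡ-≃ (ℚᵘP.≃-sym (toℚᵘ-expPartial a j))
    (ℚᵘP.≤-respʳ-≃ (ℚᵘP.≃-sym (ℚP.toℚᵘ-fromℚᵘ (+ c ℚᵘ./ 1)))
      (n/d≤n′/d′ (j !) 1 {{j !≢0}} (subst (_≤ c * j !) (sym (*-identityʳ _)) W≤c*j!))))

≤expPartial : ∀ {a} j B → B * j ! ≤ expPartialNum a j → + B / 1 ℚ.≤ expPartial a j
≤expPartial {a} j B B*j!≤W = ℚP.toℚᵘ-cancel-≤
  (ℚᵘP.≤-respʳ-≃ (ℚᵘP.≃-sym (toℚᵘ-expPartial a j))
    (ℚᵘP.≤-respˡ-≃ (ℚᵘP.≃-sym (ℚP.toℚᵘ-fromℚᵘ (+ B ℚᵘ./ 1)))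
      (n/d≤n′/d′ 1 (j !) {{_}} {{j !≢0}} (subst (B * j ! ≤_) (sym (*-identityʳ _)) B*j!≤W))))

n/1≤x⇒n≤∣⌊x⌋∣ : ∀ n (x : ℚ) → + n / 1 ℚ.≤ x → n ≤ ℤ.∣ floor x ∣
n/1≤x⇒n≤∣⌊x⌋∣ n x@(mkℚ (+ k) d-1 _) n≤x with ℚᵘP.≤-respˡ-≃ (ℚP.toℚᵘ-fromℚᵘ (+ n ℚᵘ./ 1)) (ℚP.toℚᵘ-mono-≤ n≤x)
... | *≤* n*d≤k*1 = subst (n ≤_) ⌊x⌋≡ (subst (_≤ k div suc d-1) (m*n/n≡m n (suc d-1)) (/-monoˡ-≤ (suc d-1) n*d≤k))
  where
  n*d≤k : n * suc d-1 ≤ k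
  n*d≤k = subst₂ _≤_ refl (*-identityʳ k) (ℤP.drop‿+≤+ (subst₂ ℤ._≤_ (sym (ℤP.pos-* n (suc d-1))) (sym (ℤP.pos-* k 1)) n*d≤k*1))
  ⌊x⌋≡ : k div suc d-1 ≡ ℤ.∣ floor x ∣
  ⌊x⌋≡ = cong ℤ.∣_∣ (sym (ℤP.*-identityˡ (+ (k div suc d-1))))
n/1≤x⇒n≤∣⌊x⌋∣ n x@(mkℚ ℤ.-[1+ k ] d-1 _) n≤x with ℚᵘP.≤-respˡ-≃ (ℚP.toℚᵘ-fromℚᵘ (+ n ℚᵘ./ 1)) (ℚP.toℚᵘ-mono-≤ n≤x)
... | *≤* n*d≤-k with subst₂ ℤ._≤_ (sym (ℤP.pos-* n (suc d-1))) (ℤP.*-identityʳ ℤ.-[1+ k ]) n*d≤-k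
... | ()

a^i*a!≤[a+i]! : ∀ a i → a ^ i * a ! ≤ (a + i) !
a^i*a!≤[a+i]! a zero    = ≤-reflexive (trans (*-identityˡ (a !)) (cong _! (sym (+-identityʳ a))))
a^i*a!≤[a+i]! a (suc i) = begin
  a * a ^ i * a !         ≡⟨ *-assoc a (a ^ i) (a !) ⟩
  a * (a ^ i * a !)       ≤⟨ *-monoʳ-≤ a (a^i*a!≤[a+i]! a i) ⟩
  a * (a + i) !           ≤⟨ *-monoˡ-≤ ((a + i) !) (m≤n⇒m≤1+n (m≤m+n a i)) ⟩
  suc (a + i) * (a + i) ! ≡⟨ cong _! (+-suc a i) ⟨
  (a + suc i) !           ∎
  where open ≤-Reasoning

[m+n]!≤m!*n!*2^[m+n] : ∀ m n → (m + n) ! ≤ m ! * n ! * 2 ^ (m + n)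
[m+n]!≤m!*n!*2^[m+n] zero    n       = ≤-trans (m≤m*n (n !) (2 ^ n) {{m^n≢0 2 n}})
                                          (≤-reflexive (cong (_* 2 ^ n) (sym (*-identityˡ (n !)))))
[m+n]!≤m!*n!*2^[m+n] (suc m) zero    = subst (λ k → k ! ≤ suc m ! * 1 * 2 ^ k) (sym (+-identityʳ (suc m)))
                                          (≤-trans (m≤m*n (suc m !) (2 ^ suc m) {{m^n≢0 2 (suc m)}})
                                            (≤-reflexive (cong (_* 2 ^ suc m) (sym (*-identityʳ (suc m !))))))
[m+n]!≤m!*n!*2^[m+n] (suc m) (suc n) = begin
  (suc m + suc n) * K                                   ≡⟨ *-distribʳ-+ K (suc m) (suc n) ⟩
  suc m * K + suc n * K                                 ≤⟨ +-mono-≤ (*-monoʳ-≤ (suc m) ([m+n]!≤m!*n!*2^[m+n] m (suc n)))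
                                                                    (*-monoʳ-≤ (suc n) [1+m+n]!≤) ⟩
  suc m * (m ! * suc n ! * E) + suc n * (suc m ! * n ! * E) ≡⟨ pascal m n (m !) (n !) E ⟩
  suc m ! * suc n ! * 2 ^ (suc m + suc n)                ∎
  where
  open ≤-Reasoning
  K = (m + suc n) !
  E = 2 ^ (m + suc n)
  [1+m+n]!≤ : K ≤ suc m ! * n ! * E
  [1+m+n]!≤ = subst (λ k → k ! ≤ suc m ! * n ! * 2 ^ k) (sym (+-suc m n)) ([m+n]!≤m!*n!*2^[m+n] (suc m) n)
  pascal : ∀ m n M N E → suc m * (M * (suc n * N) * E) + suc n * (suc m * M * N * E) ≡ suc m * M * (suc n * N) * (2 * E)
  pascal = solve-∀

a^i≤i!*2^[a+i] : ∀ a i → a ^ i ≤ i ! * 2 ^ (a + i)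
a^i≤i!*2^[a+i] a i = *-cancelˡ-≤ (a !) {{a !≢0}} (begin
  a ! * a ^ i             ≡⟨ *-comm (a !) (a ^ i) ⟩
  a ^ i * a !             ≤⟨ a^i*a!≤[a+i]! a i ⟩
  (a + i) !               ≤⟨ [m+n]!≤m!*n!*2^[m+n] a i ⟩
  a ! * i ! * 2 ^ (a + i) ≡⟨ *-assoc (a !) (i !) (2 ^ (a + i)) ⟩
  a ! * (i ! * 2 ^ (a + i)) ∎)
  where open ≤-Reasoning

expPartialNum≤j!*2^[a+1+j] : ∀ a j → expPartialNum a j ≤ j ! * 2 ^ (a + suc j)
expPartialNum≤j!*2^[a+1+j] a zero    = ≤-trans (m^n>0 2 (a + 1)) (≤-reflexive (sym (*-identityˡ _)))
expPartialNum≤j!*2^[a+1+j] a (suc j) = begin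
  suc j * expPartialNum a j + a ^ suc j ≤⟨ +-mono-≤ (*-monoʳ-≤ (suc j) (expPartialNum≤j!*2^[a+1+j] a j)) (a^i≤i!*2^[a+i] a (suc j)) ⟩
  suc j * (j ! * E) + suc j ! * E       ≡⟨ double (suc j) (j !) E ⟩
  suc j ! * (2 * E)                     ≡⟨ cong (λ k → suc j ! * 2 ^ k) (+-suc a (suc j)) ⟨
  suc j ! * 2 ^ (a + suc (suc j))       ∎
  where
  open ≤-Reasoning
  E = 2 ^ (a + suc j)
  double : ∀ s f E → s * (f * E) + s * f * E ≡ s * f * (2 * E)
  double = solve-∀

-- Σ_{i ≤ j} a^i/i! + a^j/j! ≤ q. Once 2a ≤ j + 1 the terms at least halve,
-- so the last term pays for the next one and the invariant propagates.
ExpInvariant : ℕ → ℕ → ℕ → Set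
ExpInvariant a q j = expPartialNum a j + a ^ j ≤ q * j !

ExpInvariant-step : ∀ {a} q {j} → 2 * a ≤ suc j → ExpInvariant a q j → ExpInvariant a q (suc j)
ExpInvariant-step {a} q {j} 2a≤1+j inv = begin
  (suc j * W + a * a ^ j) + a * a ^ j ≡⟨ regroup (suc j) W (a ^ j) a ⟩
  suc j * W + (2 * a) * a ^ j         ≤⟨ +-monoʳ-≤ (suc j * W) (*-monoˡ-≤ (a ^ j) 2a≤1+j) ⟩
  suc j * W + suc j * a ^ j           ≡⟨ *-distribˡ-+ (suc j) W (a ^ j) ⟨
  suc j * (W + a ^ j)                 ≤⟨ *-monoʳ-≤ (suc j) inv ⟩
  suc j * (q * j !)                   ≡⟨ x*[y*z]≡y*[x*z] (suc j) q (j !) ⟩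
  q * suc j !                         ∎
  where
  open ≤-Reasoning
  W = expPartialNum a j
  regroup : ∀ s w x a → (s * w + a * x) + a * x ≡ s * w + (2 * a) * x
  regroup = solve-∀
  x*[y*z]≡y*[x*z] : ∀ x y z → x * (y * z) ≡ y * (x * z)
  x*[y*z]≡y*[x*z] = solve-∀

expPartialNum≤-fromInvariant : ∀ {a} q J → 2 * a ≤ suc J → (∀ j → j ≤ J → ExpInvariant a q j) →
                               ∀ j → expPartialNum a j ≤ q * j !
expPartialNum≤-fromInvariant {a} q J 2a≤1+J base j = ≤-trans (m≤m+n _ (a ^ j)) (invariant j)
  where
  invariant : ∀ j → ExpInvariant a q j
  invariant zero    = base zero z≤n
  invariant (suc j) with suc j ≤? J
  ... | yes 1+j≤J = base (suc j) 1+j≤J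
  ... | no  1+j≰J = ExpInvariant-step q (≤-trans 2a≤1+J (s≤s (≤-pred (≰⇒> 1+j≰J)))) (invariant j)

ExpLe-fromℕ : ∀ {a} c → (∀ j → expPartialNum a j ≤ c * j !) → ExpLe a (+ c / 1)
ExpLe-fromℕ c bound j = expPartial≤ j c (bound j)

e^a≤2^[3a+2] : ∀ a c → 2 ^ (a * 3 + 2) ≤ c → ExpLe a (+ c / 1)
e^a≤2^[3a+2] a c q≤c = ExpLe-fromℕ c λ j →
  ≤-trans (expPartialNum≤-fromInvariant (2 ^ (a * 3 + 2)) (2 * a) (n≤1+n (2 * a)) base j) (*-monoˡ-≤ (j !) q≤c)
  where
  base : ∀ j → j ≤ 2 * a → ExpInvariant a (2 ^ (a * 3 + 2)) j
  base j j≤2a = begin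
    expPartialNum a j + a ^ j          ≤⟨ +-mono-≤ (expPartialNum≤j!*2^[a+1+j] a j)
                                                   (≤-trans (a^i≤i!*2^[a+i] a j) (*-monoʳ-≤ (j !) (^-monoʳ-≤ 2 (+-monoʳ-≤ a (n≤1+n j))))) ⟩
    j ! * E + j ! * E                  ≡⟨ *-distribˡ-+ (j !) E E ⟨
    j ! * (E + E)                      ≡⟨ cong (λ k → j ! * (E + k)) (+-identityʳ E) ⟨
    j ! * 2 ^ suc (a + suc j)          ≤⟨ *-monoʳ-≤ (j !) (^-monoʳ-≤ 2 exponent≤) ⟩
    j ! * 2 ^ (a * 3 + 2)              ≡⟨ *-comm (j !) _ ⟩
    2 ^ (a * 3 + 2) * j !              ∎
    where
    open ≤-Reasoning
    E = 2 ^ (a + suc j)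
    exponent≤ : suc (a + suc j) ≤ a * 3 + 2
    exponent≤ = subst₂ _≤_ (rearrange₁ a j) (rearrange₂ a) (+-monoʳ-≤ (2 + a) j≤2a)
      where
      rearrange₁ : ∀ a j → 2 + a + j ≡ suc (a + suc j)
      rearrange₁ = solve-∀
      rearrange₂ : ∀ a → 2 + a + 2 * a ≡ a * 3 + 2
      rearrange₂ = solve-∀

expPartialNum-monoˡ-≤ : ∀ {a b} j → a ≤ b → expPartialNum a j ≤ expPartialNum b j
expPartialNum-monoˡ-≤ zero    a≤b = ≤-refl
expPartialNum-monoˡ-≤ (suc j) a≤b =
  +-mono-≤ (*-monoʳ-≤ (suc j) (expPartialNum-monoˡ-≤ j a≤b)) (^-monoˡ-≤ (suc j) a≤b)

e^a≤8 : ∀ {a} c → a ≤ 2 → 8 ≤ c → ExpLe a (+ c / 1)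
e^a≤8 {a} c a≤2 8≤c = ExpLe-fromℕ c λ j →
  ≤-trans (expPartialNum-monoˡ-≤ j a≤2) (≤-trans (expPartialNum≤-fromInvariant 8 3 (≤ᵇ⇒≤ 4 4 _) base j) (*-monoˡ-≤ (j !) 8≤c))
  where
  base : ∀ j → j ≤ 3 → ExpInvariant 2 8 j
  base 0 _ = ≤ᵇ⇒≤ 2 8 _
  base 1 _ = ≤ᵇ⇒≤ 5 8 _
  base 2 _ = ≤ᵇ⇒≤ 14 16 _
  base 3 _ = ≤ᵇ⇒≤ 46 48 _
  base (suc (suc (suc (suc _)))) (s≤s (s≤s (s≤s ())))

n!≤n^n : ∀ n → n ! ≤ n ^ n
n!≤n^n zero    = ≤-refl
n!≤n^n (suc n) = *-monoʳ-≤ (suc n) (≤-trans (n!≤n^n n) (^-monoˡ-≤ n (n≤1+n n)))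

[m*n]^o≡m^o*n^o : ∀ m n o → (m * n) ^ o ≡ m ^ o * n ^ o
[m*n]^o≡m^o*n^o m n zero    = refl
[m*n]^o≡m^o*n^o m n (suc o) = trans (cong (m * n *_) ([m*n]^o≡m^o*n^o m n o)) (interchange m n (m ^ o) (n ^ o))
  where
  interchange : ∀ x y z w → x * y * (z * w) ≡ x * z * (y * w)
  interchange = solve-∀

a^j≤expPartialNum : ∀ a j → a ^ j ≤ expPartialNum a j
a^j≤expPartialNum a zero    = ≤-refl
a^j≤expPartialNum a (suc j) = m≤n+m (a ^ suc j) (suc j * expPartialNum a j)

4^J*J!≤expPartialNum : ∀ {a} J → 4 * J ≤ a → 4 ^ J * J ! ≤ expPartialNum a J
4^J*J!≤expPartialNum {a} J 4J≤a = begin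
  4 ^ J * J !     ≤⟨ *-monoʳ-≤ (4 ^ J) (n!≤n^n J) ⟩
  4 ^ J * J ^ J   ≡⟨ [m*n]^o≡m^o*n^o 4 J J ⟨
  (4 * J) ^ J     ≤⟨ ^-monoˡ-≤ J 4J≤a ⟩
  a ^ J           ≤⟨ a^j≤expPartialNum a J ⟩
  expPartialNum a J ∎
  where open ≤-Reasoning

ExpLe⇒4^J≤∣⌊x⌋∣ : ∀ {a x} J → ExpLe a x → 4 * J ≤ a → 4 ^ J ≤ ℤ.∣ floor x ∣
ExpLe⇒4^J≤∣⌊x⌋∣ {a} {x} J e^a≤x 4J≤a =
  n/1≤x⇒n≤∣⌊x⌋∣ (4 ^ J) x (ℚP.≤-trans (≤expPartial J (4 ^ J) (4^J*J!≤expPartialNum J 4J≤a)) (e^a≤x J))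


-- Size estimates
2^[3m+2]≤13^m : ∀ {m} → 3 ≤ m → 2 ^ (m * 3 + 2) ≤ 13 ^ m
2^[3m+2]≤13^m {0} ()
2^[3m+2]≤13^m {1} (s≤s ())
2^[3m+2]≤13^m {2} (s≤s (s≤s ()))
2^[3m+2]≤13^m {3} _ = ≤ᵇ⇒≤ 2048 2197 _
2^[3m+2]≤13^m {suc m@(suc (suc (suc _)))} _ = begin
  2 * (2 * (2 * 2 ^ (m * 3 + 2))) ≡⟨ eight (2 ^ (m * 3 + 2)) ⟩
  8 * 2 ^ (m * 3 + 2)             ≤⟨ *-mono-≤ (≤ᵇ⇒≤ 8 13 _) (2^[3m+2]≤13^m {m} (s≤s (s≤s (s≤s z≤n)))) ⟩
  13 * 13 ^ m                     ∎
  where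
  open ≤-Reasoning
  eight : ∀ x → 2 * (2 * (2 * x)) ≡ 8 * x
  eight = solve-∀

m≤2^m : ∀ m → m ≤ 2 ^ m
m≤2^m zero    = z≤n
m≤2^m (suc m) = +-mono-≤ (m^n>0 2 m) (≤-trans (m≤2^m m) (m≤m+n (2 ^ m) 0))

N*[2^N+1]^12≤2^[m+12[m+1]] : ∀ {N m} → N ≤ m → N * (2 ^ N + 1) ^ 12 ≤ 2 ^ (m + suc m * 12)
N*[2^N+1]^12≤2^[m+12[m+1]] {N} {m} N≤m = begin
  N * (2 ^ N + 1) ^ 12       ≤⟨ *-mono-≤ (≤-trans N≤m (m≤2^m m)) (^-monoˡ-≤ 12 2^N+1≤2^[1+m]) ⟩
  2 ^ m * (2 ^ suc m) ^ 12   ≡⟨ cong (2 ^ m *_) (^-*-assoc 2 (suc m) 12) ⟩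
  2 ^ m * 2 ^ (suc m * 12)   ≡⟨ ^-distribˡ-+-* 2 m (suc m * 12) ⟨
  2 ^ (m + suc m * 12)       ∎
  where
  open ≤-Reasoning
  2^N+1≤2^[1+m] : 2 ^ N + 1 ≤ 2 ^ suc m
  2^N+1≤2^[1+m] = ≤-trans (+-monoʳ-≤ (2 ^ N) (≤-trans (m^n>0 2 N) (m≤m+n (2 ^ N) 0))) (^-monoʳ-≤ 2 (s≤s N≤m))

m+12[m+1]≤2⌊m²/4⌋ : ∀ {m} → 27 ≤ m → m + suc m * 12 ≤ 2 * (m * m div 4)
m+12[m+1]≤2⌊m²/4⌋ {m} 27≤m = *-cancelˡ-≤ 2 (+-cancelʳ-≤ 3 _ _ (begin
  2 * X + 3                    ≤⟨ m≤m+n (2 * X + 3) (28 * t + t * t) ⟩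
  2 * X + 3 + (28 * t + t * t) ≡⟨ subst (λ m → 2 * (m + suc m * 12) + 3 + (28 * t + t * t) ≡ m * m) 27+t≡m (square t) ⟩
  m * m                        ≡⟨ m≡m%n+[m/n]*n (m * m) 4 ⟩
  m * m % 4 + k * 4            ≤⟨ +-monoˡ-≤ (k * 4) (≤-pred (m%n<n (m * m) 4)) ⟩
  3 + k * 4                    ≡⟨ +-comm 3 (k * 4) ⟩
  k * 4 + 3                    ≡⟨ cong (_+ 3) (*-comm k 4) ⟩
  4 * k + 3                    ≡⟨ cong (_+ 3) (*-assoc 2 2 k) ⟩
  2 * (2 * k) + 3              ∎))
  where
  open ≤-Reasoning
  t = proj₁ (m≤n⇒∃[o]m+o≡n 27≤m)
  27+t≡m = proj₂ (m≤n⇒∃[o]m+o≡n 27≤m)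
  X = m + suc m * 12
  k = m * m div 4
  square : ∀ t → 2 * ((27 + t) + suc (27 + t) * 12) + 3 + (28 * t + t * t) ≡ (27 + t) * (27 + t)
  square = solve-∀

N*[2^N+1]^12≤4^⌊m²/4⌋ : ∀ {N m} → 27 ≤ m → N ≤ m → N * (2 ^ N + 1) ^ 12 ≤ 4 ^ (m * m div 4)
N*[2^N+1]^12≤4^⌊m²/4⌋ {N} {m} 27≤m N≤m = begin
  N * (2 ^ N + 1) ^ 12  ≤⟨ N*[2^N+1]^12≤2^[m+12[m+1]] N≤m ⟩
  2 ^ (m + suc m * 12)  ≤⟨ ^-monoʳ-≤ 2 (m+12[m+1]≤2⌊m²/4⌋ 27≤m) ⟩
  2 ^ (2 * k)           ≡⟨ ^-*-assoc 2 2 k ⟨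
  4 ^ k                 ∎
  where
  open ≤-Reasoning
  k = m * m div 4


-- The function d
d-witness : ∀ m → 1 ≤ d m → ∃[ N ] Novak N × N ≤ m × d m ≡ ω (2 ^ N + 1)
d-witness (suc m) 1≤d with novak? (suc m)
... | no _ with d-witness m 1≤d
...   | N , nv , N≤m , d≡ = N , nv , m≤n⇒m≤1+n N≤m , d≡
d-witness (suc m) 1≤d | yes nv with d m ≤? ω (2 ^ suc m + 1)
... | yes d≤ω = suc m , nv , ≤-refl , m≤n⇒m⊔n≡n d≤ω
... | no  d≰ω with d-witness m (≤-trans (s≤s z≤n) (≰⇒> d≰ω))
...   | N , nv′ , N≤m , d≡ = N , nv′ , m≤n⇒m≤1+n N≤m , trans (m≥n⇒m⊔n≡m (<⇒≤ (≰⇒> d≰ω))) d≡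

ω≤d : ∀ {N} m → Novak N → N ≤ m → ω (2 ^ N + 1) ≤ d m
ω≤d zero    (() , _) z≤n
ω≤d (suc m) nv N≤1+m with novak? (suc m) | m≤n⇒m<n∨m≡n N≤1+m
... | yes _  | inj₂ refl = m≤n⊔m (d m) _
... | no ¬nv | inj₂ refl = contradiction nv ¬nv
... | yes _  | inj₁ N<1+m = ≤-trans (ω≤d m nv (≤-pred N<1+m)) (m≤m⊔n (d m) _)
... | no _   | inj₁ N<1+m = ω≤d m nv (≤-pred N<1+m)

8≤novakCount : ∀ {X} → 513 ≤ X → 8 ≤ novakCountℕ X
8≤novakCount {X} 513≤X = length≤novakCount X (filter novak? (upTo 514))
  (Unique.filter⁺ novak? (Unique.upTo⁺ 514))
  (All.tabulate λ n∈ → let (n∈upTo , nv) = ∈-filter⁻ novak? n∈ in ≤-trans (≤-pred (∈-upTo⁻ n∈upTo)) 513≤X , nv)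

d[26]≡2 : d 26 ≡ 2
d[26]≡2 = refl

27≤N : ∀ {N} → Novak N → 3 ≤ ω (2 ^ N + 1) → 27 ≤ N
27≤N {N} nv 3≤ω = ≮⇒≥ λ N<27 → <⇒≱ 3≤ω (subst (ω (2 ^ N + 1) ≤_) d[26]≡2 (ω≤d 26 nv (≤-pred N<27)))

e^ω≤𝒩B : ∀ {x m N} → LeSqrtLn m x → Novak N → N ≤ m → 3 ≤ ω (2 ^ N + 1) → ExpLe (ω (2 ^ N + 1)) (+ 𝒩B x / 1)
e^ω≤𝒩B {x} {m} {N} e^m²≤x nv N≤m 3≤k = e^a≤2^[3a+2] k (𝒩B x) (≤-trans (2^[3m+2]≤13^m 3≤k) 13^k≤𝒩B)
  where
  k = ω (2 ^ N + 1)
  J = m * m div 4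
  4^J≤⌊x⌋ : 4 ^ J ≤ ℤ.∣ floor x ∣
  4^J≤⌊x⌋ = ExpLe⇒4^J≤∣⌊x⌋∣ J e^m²≤x (subst (_≤ m * m) (*-comm J 4) (m/n*n≤m (m * m) 4))
  13^k≤𝒩B : 13 ^ k ≤ 𝒩B x
  13^k≤𝒩B = [1+r]^ω≤novakCount 12 nv (≤-trans (N*[2^N+1]^12≤4^⌊m²/4⌋ (≤-trans (27≤N nv 3≤k) N≤m) N≤m) 4^J≤⌊x⌋)

corollary3 : (x : ℚ) → (+ 15000 / 1) < x →
    (m : ℕ) → LeSqrtLn m x → ExpLe (d m) (+ (𝒩B x) / 1)
corollary3 x 15000<x m e^m²≤x = [ small , large ]′ (≤-<-connex (d m) 2)
  where
  small : d m ≤ 2 → ExpLe (d m) (+ 𝒩B x / 1)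
  small d≤2 = e^a≤8 (𝒩B x) d≤2 (8≤novakCount (≤-trans (≤ᵇ⇒≤ 513 15000 _) (n/1≤x⇒n≤∣⌊x⌋∣ 15000 x (ℚP.<⇒≤ 15000<x))))
  large : 3 ≤ d m → ExpLe (d m) (+ 𝒩B x / 1)
  large 3≤d =
    let (N , nv , N≤m , d≡ω) = d-witness m (≤-trans (s≤s z≤n) 3≤d)
    in subst (λ a → ExpLe a (+ 𝒩B x / 1)) (sym d≡ω) (e^ω≤𝒩B e^m²≤x nv N≤m (subst (3 ≤_) d≡ω 3≤d))
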